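{- Let $n\ge 1$, let $A\in M_n(\mathbb{F}_2)$ be a tridiagonal matrix all of whose subdiagonal and superdiagonal entries equal $1$ (diagonal entries arbitrary), and let $u=(u_1,\dots,u_n)^\top\in\mathbb{F}_2^n$ be nonzero with $Au=0$. Then $u_1=u_n=1$ and $u$ has no two consecutive entries both equal to $0$. -}

module Defs where

open import Data.Bool using (Bool; true; false; _xor_; _∧_)
open import Data.Nat using (ℕ; suc; _+_; _≤_)
open import Data.Fin using (Fin; toℕ)
open import Data.Vec.Functional using (foldr)
open import Relation.Binary.PropositionalEquality using (_≡_)
open import Data.Product using (∃; _×_)

-- The field F₂ is modelled by Bool: addition = xor, multiplication = ∧, 0 = false, 1 = true.

Mat : ℕ → Set
Mat n = Fin n → Fin n → Bool

Vec₂ : ℕ → Set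
Vec₂ n = Fin n → Bool

Σ₂ : ∀ {n} → (Fin n → Bool) → Bool
Σ₂ f = foldr _xor_ false f

_·_ : ∀ {n} → Mat n → Vec₂ n → Vec₂ n
(A · u) i = Σ₂ (λ j → A i j ∧ u j)

TridiagOnes : ∀ {n} → Mat n → Set
TridiagOnes {n} A =
  (∀ (i j : Fin n) → (suc (suc (toℕ i)) ≤ toℕ j → A i j ≡ false)
                   × (suc (suc (toℕ j)) ≤ toℕ i → A i j ≡ false)
                   × (suc (toℕ i) ≡ toℕ j → A i j ≡ true)
                   × (suc (toℕ j) ≡ toℕ i → A i j ≡ true))

NonZeroVec : ∀ {n} → Vec₂ n → Set
NonZeroVec {n} u = ∃ λ (i : Fin n) → u i ≡ true

-- Row i of A u = 0 reads u_{i-1} + a_ii u_i + u_{i+1} = 0, with u padded by a zero at each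
-- end. Hence two consecutive zeros of the padded vector force the next entry to vanish, in
-- either direction, so they spread to all of u, contradicting u ≠ 0. The conclusions are the
-- three ways a pair of consecutive zeros could occur: at the left end, at the right end, or
-- inside u.
module Submission where

open import Defs
open import Data.Bool using (Bool; true; false; _xor_; _∧_)
open import Data.Bool.Properties using (xor-identityʳ; ∧-zeroʳ; ¬-not)
open import Data.Nat using (ℕ; suc; zero; _≤_; _<_; z≤n; s≤s)
open import Data.Nat.Properties using (suc-injective; ≤-refl; ≤-trans; <-trans; <⇒≤; <-irrefl; n<1+n)
open import Data.Fin using (Fin; zero; fromℕ; inject₁; toℕ; fromℕ<) renaming (suc to fsuc)
open import Data.Fin.Properties using (toℕ-injective; toℕ-fromℕ<; toℕ-fromℕ; toℕ-inject₁; toℕ<n)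
import Data.Fin.Properties as Fin
open import Data.Product using (_×_; _,_; proj₁; proj₂)
open import Data.Sum using (_⊎_; inj₁; inj₂)
import Data.Sum as Sum
open import Data.Empty using (⊥-elim)
open import Function using (_∘_)
open import Relation.Binary.PropositionalEquality
open import Relation.Nullary using (¬_)

Σ₂-zero : ∀ {n} (f : Fin n → Bool) → (∀ j → f j ≡ false) → Σ₂ f ≡ false
Σ₂-zero {zero}  f f≡0 = refl
Σ₂-zero {suc n} f f≡0 rewrite f≡0 zero = Σ₂-zero (f ∘ fsuc) (f≡0 ∘ fsuc)

Σ₂-single : ∀ {n} (f : Fin n → Bool) (t : Fin n) → (∀ j → j ≢ t → f j ≡ false) → Σ₂ f ≡ f t
Σ₂-single f zero f≡0 =
  trans (cong (f zero xor_) (Σ₂-zero (f ∘ fsuc) (λ j → f≡0 (fsuc j) λ ()))) (xor-identityʳ (f zero))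
Σ₂-single f (fsuc t) f≡0 rewrite f≡0 zero (λ ()) =
  Σ₂-single (f ∘ fsuc) t (λ j j≢t → f≡0 (fsuc j) (j≢t ∘ Fin.suc-injective))

Adjacent : ℕ → ℕ → Set
Adjacent a b = suc a ≡ b ⊎ suc b ≡ a

Near : ℕ → ℕ → Set
Near a b = a ≡ b ⊎ Adjacent a b

Far : ℕ → ℕ → Set
Far a b = suc (suc a) ≤ b ⊎ suc (suc b) ≤ a

near-or-far : ∀ a b → Near a b ⊎ Far a b
near-or-far zero          zero          = inj₁ (inj₁ refl)
near-or-far zero          (suc zero)    = inj₁ (inj₂ (inj₁ refl))
near-or-far (suc zero)    zero          = inj₁ (inj₂ (inj₂ refl))
near-or-far zero          (suc (suc b)) = inj₂ (inj₁ (s≤s (s≤s z≤n)))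
near-or-far (suc (suc a)) zero          = inj₂ (inj₂ (s≤s (s≤s z≤n)))
near-or-far (suc a)       (suc b)       =
  Sum.map (Sum.map (cong suc) (Sum.map (cong suc) (cong suc))) (Sum.map s≤s s≤s) (near-or-far a b)

module _ {n : ℕ} {A : Mat n} (tri : TridiagOnes A) {i j : Fin n} where

  tridiag-far : Far (toℕ i) (toℕ j) → A i j ≡ false
  tridiag-far (inj₁ far) = proj₁ (tri i j) far
  tridiag-far (inj₂ far) = proj₁ (proj₂ (tri i j)) far

  tridiag-adjacent : Adjacent (toℕ i) (toℕ j) → A i j ≡ true
  tridiag-adjacent (inj₁ adj) = proj₁ (proj₂ (proj₂ (tri i j))) adj
  tridiag-adjacent (inj₂ adj) = proj₂ (proj₂ (proj₂ (tri i j))) adj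

module _ {n : ℕ} (u : Vec₂ n) where

  -- Position q of u padded with a zero at each end: q = 0 and q > n are the padding, and
  -- position suc k is the entry u k.
  ZeroAt : ℕ → Set
  ZeroAt q = ∀ j → suc (toℕ j) ≡ q → u j ≡ false

  ZeroPair : ℕ → Set
  ZeroPair q = ZeroAt q × ZeroAt (suc q)

  zeroAt-start : ZeroAt 0
  zeroAt-start j ()

  zeroAt-beyond : ∀ {q} → n < q → ZeroAt q
  zeroAt-beyond n<q j sj≡q = ⊥-elim (<-irrefl refl (≤-trans n<q (subst (_≤ n) sj≡q (toℕ<n j))))

  zeroAt-entry : ∀ j → u j ≡ false → ZeroAt (suc (toℕ j))
  zeroAt-entry j uj≡0 k sk≡sj = subst (λ x → u x ≡ false) (sym (toℕ-injective (suc-injective sk≡sj))) uj≡0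

module KernelOfTridiagOnes {n : ℕ} {A : Mat n} (tri : TridiagOnes A)
                           {u : Vec₂ n} (Au≡0 : ∀ i → (A · u) i ≡ false) where

  adjacent-zero : (i t : Fin n) → Adjacent (toℕ i) (toℕ t)
    → (∀ k → k ≢ t → Near (toℕ i) (toℕ k) → u k ≡ false) → u t ≡ false
  adjacent-zero i t adj others = begin
    u t         ≡⟨ cong (_∧ u t) (sym (tridiag-adjacent tri adj)) ⟩
    A i t ∧ u t ≡⟨ sym (Σ₂-single (λ k → A i k ∧ u k) t off-t) ⟩
    (A · u) i   ≡⟨ Au≡0 i ⟩
    false       ∎
    where
    open ≡-Reasoning
    off-t : ∀ k → k ≢ t → A i k ∧ u k ≡ false
    off-t k k≢t with near-or-far (toℕ i) (toℕ k)
    ... | inj₁ near = trans (cong (A i k ∧_) (others k k≢t near)) (∧-zeroʳ (A i k))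
    ... | inj₂ far  = cong (_∧ u k) (tridiag-far tri far)

  zeroPair-suc : ∀ {p} → ZeroPair u p → ZeroPair u (suc p)
  zeroPair-suc {p} (zp , zsp) = zsp , zssp
    where
    zssp : ZeroAt u (suc (suc p))
    zssp j sj≡ssp = adjacent-zero i j (inj₁ (trans (cong suc toℕi≡p) (sym j≡sp))) others
      where
      j≡sp = suc-injective sj≡ssp
      p<n : p < n
      p<n = <-trans (n<1+n p) (subst (_< n) j≡sp (toℕ<n j))
      i = fromℕ< p<n
      toℕi≡p = toℕ-fromℕ< p<n
      others : ∀ k → k ≢ j → Near (toℕ i) (toℕ k) → u k ≡ false
      others k k≢j (inj₁ i≡k)         = zsp k (cong suc (trans (sym i≡k) toℕi≡p))
      others k k≢j (inj₂ (inj₂ sk≡i)) = zp k (trans sk≡i toℕi≡p)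
      others k k≢j (inj₂ (inj₁ si≡k)) =
        ⊥-elim (k≢j (toℕ-injective (trans (sym si≡k) (trans (cong suc toℕi≡p) (sym j≡sp)))))

  zeroPair-pred : ∀ {p} → p < n → ZeroPair u (suc p) → ZeroPair u p
  zeroPair-pred {p} p<n (zsp , zssp) = zp , zsp
    where
    i = fromℕ< p<n
    toℕi≡p = toℕ-fromℕ< p<n
    zp : ZeroAt u p
    zp j sj≡p = adjacent-zero i j (inj₂ (trans sj≡p (sym toℕi≡p))) others
      where
      others : ∀ k → k ≢ j → Near (toℕ i) (toℕ k) → u k ≡ false
      others k k≢j (inj₁ i≡k)         = zsp k (cong suc (trans (sym i≡k) toℕi≡p))
      others k k≢j (inj₂ (inj₁ si≡k)) = zssp k (cong suc (trans (sym si≡k) (cong suc toℕi≡p)))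
      others k k≢j (inj₂ (inj₂ sk≡i)) =
        ⊥-elim (k≢j (toℕ-injective (suc-injective (trans sk≡i (trans toℕi≡p (sym sj≡p))))))

  zeroPair-from-start : ZeroPair u 0 → ∀ q → ZeroPair u q
  zeroPair-from-start z zero    = z
  zeroPair-from-start z (suc q) = zeroPair-suc (zeroPair-from-start z q)

  zeroPair-to-start : ∀ {p} → p ≤ n → ZeroPair u p → ZeroPair u 0
  zeroPair-to-start {zero}  _     z = z
  zeroPair-to-start {suc p} sp≤n z = zeroPair-to-start (<⇒≤ sp≤n) (zeroPair-pred sp≤n z)

  zeroPair⇒zero : ∀ {p} → p ≤ n → ZeroPair u p → ∀ j → u j ≡ false
  zeroPair⇒zero p≤n z j = proj₁ (zeroPair-from-start (zeroPair-to-start p≤n z) (suc (toℕ j))) j refl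

mainTheorem4 : (m : ℕ) (A : Mat (suc m)) (u : Vec₂ (suc m))
    → TridiagOnes A → NonZeroVec u → (∀ i → (A · u) i ≡ false)
    → (u zero ≡ true) × (u (fromℕ m) ≡ true)
    × (∀ (i : Fin m) → ¬ ((u (inject₁ i) ≡ false) × (u (fsuc i) ≡ false)))
mainTheorem4 m A u tri (j , uj≡1) Au≡0 = first , last , inner
  where
  open KernelOfTridiagOnes tri {u} Au≡0

  no-zeroPair : ∀ {p} → p ≤ suc m → ¬ ZeroPair u p
  no-zeroPair p≤n z with trans (sym uj≡1) (zeroPair⇒zero p≤n z j)
  ... | ()

  first : u zero ≡ true
  first = ¬-not λ u₀≡0 → no-zeroPair z≤n (zeroAt-start u , zeroAt-entry u zero u₀≡0)

  last : u (fromℕ m) ≡ true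
  last = ¬-not λ uₘ≡0 → no-zeroPair ≤-refl
    (subst (ZeroAt u ∘ suc) (toℕ-fromℕ m) (zeroAt-entry u (fromℕ m) uₘ≡0) , zeroAt-beyond u ≤-refl)

  inner : ∀ (i : Fin m) → ¬ ((u (inject₁ i) ≡ false) × (u (fsuc i) ≡ false))
  inner i (uᵢ≡0 , uᵢ₊₁≡0) = no-zeroPair (s≤s (<⇒≤ (toℕ<n i)))
    (subst (ZeroAt u ∘ suc) (toℕ-inject₁ i) (zeroAt-entry u (inject₁ i) uᵢ≡0) , zeroAt-entry u (fsuc i) uᵢ₊₁≡0)
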